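{- For all contexts $\Gamma,\Delta$, variables $x,y$, $s\in\mathcal{C}$, term $A$ and substitution $\sigma$: if $x\notin\mathrm{dom}\,\Gamma$, $y\notin\mathrm{dom}\,\Delta$, $\Gamma\vdash A:\mathsf{c}\,s$, $\Delta\vdash A\bullet\sigma:\mathsf{c}\,s$ and $\sigma:\Gamma\rightharpoonup\Delta$, then $(\sigma,x:=\mathsf{v}\,y):(\Gamma,x:A)\rightharpoonup(\Delta,y:A\bullet\sigma)$.
   Context: Variables $\mathcal{V}$: a type with decidable equality and maps $\mathrm{encode}:\mathcal{V}\to\mathbb{N}$, $\mathrm{decode}:\mathbb{N}\to\mathcal{V}$ with $\mathrm{encode}(\mathrm{decode}\,n)=n$. Constants $\mathcal{C}$: any type. Terms: $\mathsf{c}\,k$, $\mathsf{v}\,x$, $\lambda[x:A]M$, $\Pi[x:A]B$, $M\cdot N$. Free-variable list: $\mathrm{fv}(\mathsf{c}\,k)=[\,]$, $\mathrm{fv}(\mathsf{v}\,x)=[x]$, $\mathrm{fv}(\lambda[x:A]M)=\mathrm{fv}\,A\mathbin{++}(\mathrm{fv}\,M-x)$, likewise $\Pi$, $\mathrm{fv}(M\cdot N)=\mathrm{fv}\,M\mathbin{++}\mathrm{fv}\,N$ ($xs-x$ removes all occurrences of $x$). Substitutions $\sigma:\mathcal{V}\to\Lambda$; $\iota\,x=\mathsf{v}\,x$; $(\sigma,x:=N)$ sends $x$ to $N$, $y\neq x$ to $\sigma\,y$. Fix $\chi':\mathrm{List}\,\mathbb{N}\to\mathbb{N}$ with $\chi'(ns)\notin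 ns$; $X'(xs)=\mathrm{decode}(\chi'(\mathrm{map\ encode}\ xs))$; $X(\sigma,xs)=X'$(concatenation of $\mathrm{fv}(\sigma\,y)$ for $y$ in $xs$). Substitution: $\mathsf{c}\,k\bullet\sigma=\mathsf{c}\,k$, $\mathsf{v}\,x\bullet\sigma=\sigma\,x$, $(M\cdot N)\bullet\sigma=(M\bullet\sigma)\cdot(N\bullet\sigma)$, $(\lambda[x:A]M)\bullet\sigma=\lambda[y:A\bullet\sigma](M\bullet(\sigma,x:=\mathsf{v}\,y))$ with $y=X(\sigma,\mathrm{fv}\,M-x)$, analogously for $\Pi$ (with $y=X(\sigma,\mathrm{fv}\,B-x)$). $M[x:=N]=M\bullet(\iota,x:=N)$. Alpha-conversion $\sim_\alpha$: inductive, $\mathsf{c}\,k\sim_\alpha\mathsf{c}\,k$, $\mathsf{v}\,x\sim_\alpha\mathsf{v}\,x$, congruence for application, and $\lambda[x:A]M\sim_\alpha\lambda[x':A']M'$ whenever $A\sim_\alpha A'$, $y\notin\mathrm{fv}\,M-x$, $y\notin\mathrm{fv}\,M'-x'$ and $M[x:=\mathsf{v}\,y]=M'[x':=\mathsf{v}\,y]$ syntactically, for some $y$ (same for $\Pi$). Beta: the contextual closure of a relation $S$ is the least relation containing $S$ and closed under rewriting in the body or annotation of $\lambda$, in the codomain or domain of $\Pi$, and in either side of an application; $\to_\beta$ is the contextual closure of $(\lambda[x:A]M)\cdot N\ \triangleright\ M[x:=N]$; $\simeq_\beta$ is the reflexive–symmetric–transitive closure of $\sim_\alpha\cup\to_\beta$.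 PTS: fix $\mathcal{A}\subseteq\mathcal{C}^2$ (axioms) and $\mathcal{R}\subseteq\mathcal{C}^3$ (rules). A context is a list of pairs $(x,A)$; $\Gamma,x:A$ denotes $(x,A)::\Gamma$; $\mathrm{dom}\,\Gamma$ is the list of first components. The judgments $\Gamma\ \mathrm{ok}$ and $\Gamma\vdash M:A$ are mutually inductively defined by: (nil) $[\,]\ \mathrm{ok}$; (cons) if $\Gamma\ \mathrm{ok}$, $\Gamma\vdash A:\mathsf{c}\,s$ and $x\notin\mathrm{dom}\,\Gamma$ then $(\Gamma,x:A)\ \mathrm{ok}$; (sort) if $\Gamma\ \mathrm{ok}$ and $\mathcal{A}\,s_1\,s_2$ then $\Gamma\vdash\mathsf{c}\,s_1:\mathsf{c}\,s_2$; (prod) if $\Gamma\vdash A:\mathsf{c}\,s_1$, for every $y\notin\mathrm{dom}\,\Gamma$ we have $\Gamma,y:A\vdash B[x:=\mathsf{v}\,y]:\mathsf{c}\,s_2$, and $\mathcal{R}\,s_1\,s_2\,s_3$, then $\Gamma\vdash\Pi[x:A]B:\mathsf{c}\,s_3$; (var) if $\Gamma\ \mathrm{ok}$ and $(x,A)\in\Gamma$ then $\Gamma\vdash\mathsf{v}\,x:A$; (abs) if $\Gamma\vdash A:\mathsf{c}\,s_1$, for every $z\notin\mathrm{dom}\,\Gamma$ both $\Gamma,z:A\vdash B[y:=\mathsf{v}\,z]:\mathsf{c}\,s_2$ and $\Gamma,z:A\vdash M[x:=\mathsf{v}\,z]:B[y:=\mathsf{v}\,z]$, and $\mathcal{R}\,s_1\,s_2\,s_3$,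 then $\Gamma\vdash\lambda[x:A]M:\Pi[y:A]B$; (app) if $\Gamma\vdash M:\Pi[x:A]B$, $\Gamma\vdash N:A$ and $\Gamma\vdash B[x:=N]:\mathsf{c}\,s$, then $\Gamma\vdash M\cdot N:B[x:=N]$; (conv) if $\Gamma\vdash M:A$, $A\simeq_\beta B$ and $\Gamma\vdash B:\mathsf{c}\,s$ then $\Gamma\vdash M:B$. A substitution $\sigma$ is well-typed from $\Gamma$ to $\Delta$, written $\sigma:\Gamma\rightharpoonup\Delta$, if for every $(x,A)\in\Gamma$ we have $\Delta\vdash\sigma\,x:A\bullet\sigma$. -}

module Defs where

open import Level using (Level; suc; _⊔_)
open import Data.Nat using (ℕ)
open import Data.List using (List; []; _∷_; _++_; map; filter; concatMap)
open import Data.List.Membership.Propositional using (_∈_; _∉_)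
open import Data.Product using (_×_; _,_; proj₁)
open import Relation.Nullary using (¬_; Dec; yes; no)
open import Relation.Nullary.Decidable using (¬?)
open import Relation.Binary using (DecidableEquality)
open import Relation.Binary.PropositionalEquality using (_≡_)
open import Relation.Binary.Construct.Closure.Equivalence using (EqClosure)
open import Relation.Binary.Construct.Union using (_∪_)

record Setup : Set₁ where
  field
    V       : Set
    _≟V_    : DecidableEquality V
    encode  : V → ℕ
    decode  : ℕ → V
    encode-decode : ∀ n → encode (decode n) ≡ n
    C       : Set
    χ'      : List ℕ → ℕ
    χ'-fresh : ∀ ns → χ' ns ∉ ns
    Ax      : C → C → Set
    Rl      : C → C → C → Set

module Theory (S : Setup) where
  open Setup S public

  data Term : Set where
    c   : C → Term
    v   : V → Term
    lam : V → Term → Term → Term   -- λ[x:A]M  is  lam x A M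
    pi  : V → Term → Term → Term   -- Π[x:A]B  is  pi x A B
    _·_ : Term → Term → Term

  _-_ : List V → V → List V
  xs - x = filter (λ y → ¬? (y ≟V x)) xs

  fv : Term → List V
  fv (c k) = []
  fv (v x) = x ∷ []
  fv (lam x A M) = fv A ++ (fv M - x)
  fv (pi x A B) = fv A ++ (fv B - x)
  fv (M · N) = fv M ++ fv N

  infixl 30 _•_
  infix 35 _[_≔_]
  infixl 25 _,_≔_
  infixl 25 _,,_∶_
  infix 10 _⊢_∶_
  infix 10 _∶_⇀_
  infixl 40 _·_

  Subst : Set
  Subst = V → Term

  ι : Subst
  ι x = v x

  _,_≔_ : Subst → V → Term → Subst
  (σ , x ≔ N) y with y ≟V x
  ... | yes _ = N
  ... | no  _ = σ y

  X' : List V → V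
  X' xs = decode (χ' (map encode xs))

  X : Subst → List V → V
  X σ xs = X' (concatMap (λ y → fv (σ y)) xs)

  _•_ : Term → Subst → Term
  c k • σ = c k
  v x • σ = σ x
  (M · N) • σ = (M • σ) · (N • σ)
  lam x A M • σ = let y = X σ (fv M - x) in lam y (A • σ) (M • (σ , x ≔ v y))
  pi x A B • σ = let y = X σ (fv B - x) in pi y (A • σ) (B • (σ , x ≔ v y))

  _[_≔_] : Term → V → Term → Term
  M [ x ≔ N ] = M • (ι , x ≔ N)

  infix 4 _~α_
  data _~α_ : Term → Term → Set where
    α-c   : ∀ k → c k ~α c k
    α-v   : ∀ x → v x ~α v x
    α-app : ∀ {M M' N N'} → M ~α M' → N ~α N' → (M · N) ~α (M' · N')
    α-lam : ∀ {x x' A A' M M'} y → A ~α A' → y ∉ (fv M - x) → y ∉ (fv M' - x')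
          → M [ x ≔ v y ] ≡ M' [ x' ≔ v y ] → lam x A M ~α lam x' A' M'
    α-pi  : ∀ {x x' A A' B B'} y → A ~α A' → y ∉ (fv B - x) → y ∉ (fv B' - x')
          → B [ x ≔ v y ] ≡ B' [ x' ≔ v y ] → pi x A B ~α pi x' A' B'

  data Ctx (R : Term → Term → Set) : Term → Term → Set where
    base  : ∀ {M N} → R M N → Ctx R M N
    lamB  : ∀ {x A M M'} → Ctx R M M' → Ctx R (lam x A M) (lam x A M')
    lamA  : ∀ {x A A' M} → Ctx R A A' → Ctx R (lam x A M) (lam x A' M)
    piB   : ∀ {x A B B'} → Ctx R B B' → Ctx R (pi x A B) (pi x A B')
    piA   : ∀ {x A A' B} → Ctx R A A' → Ctx R (pi x A B) (pi x A' B)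
    appL  : ∀ {M M' N} → Ctx R M M' → Ctx R (M · N) (M' · N)
    appR  : ∀ {M N N'} → Ctx R N N' → Ctx R (M · N) (M · N')

  data BetaRoot : Term → Term → Set where
    β : ∀ x A M N → BetaRoot (lam x A M · N) (M [ x ≔ N ])

  _→β_ : Term → Term → Set
  _→β_ = Ctx BetaRoot

  _≃β_ : Term → Term → Set
  _≃β_ = EqClosure (_~α_ ∪ _→β_)

  Context : Set
  Context = List (V × Term)

  _,,_∶_ : Context → V → Term → Context
  Γ ,, x ∶ A = (x , A) ∷ Γ

  dom : Context → List V
  dom = map proj₁

  mutual
    data _ok : Context → Set where
      nil  : [] ok
      cons : ∀ {Γ x A s} → Γ ok → Γ ⊢ A ∶ c s → x ∉ dom Γ → (Γ ,, x ∶ A) ok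

    data _⊢_∶_ : Context → Term → Term → Set where
      sort : ∀ {Γ s₁ s₂} → Γ ok → Ax s₁ s₂ → Γ ⊢ c s₁ ∶ c s₂
      prod : ∀ {Γ x A B s₁ s₂ s₃} → Γ ⊢ A ∶ c s₁
           → (∀ y → y ∉ dom Γ → (Γ ,, y ∶ A) ⊢ B [ x ≔ v y ] ∶ c s₂)
           → Rl s₁ s₂ s₃ → Γ ⊢ pi x A B ∶ c s₃
      var  : ∀ {Γ x A} → Γ ok → (x , A) ∈ Γ → Γ ⊢ v x ∶ A
      abs  : ∀ {Γ x y A B M s₁ s₂ s₃} → Γ ⊢ A ∶ c s₁
           → (∀ z → z ∉ dom Γ → (Γ ,, z ∶ A) ⊢ B [ y ≔ v z ] ∶ c s₂)
           → (∀ z → z ∉ dom Γ → (Γ ,, z ∶ A) ⊢ M [ x ≔ v z ] ∶ B [ y ≔ v z ])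
           → Rl s₁ s₂ s₃ → Γ ⊢ lam x A M ∶ pi y A B
      app  : ∀ {Γ M N x A B s} → Γ ⊢ M ∶ pi x A B → Γ ⊢ N ∶ A
           → Γ ⊢ B [ x ≔ N ] ∶ c s → Γ ⊢ M · N ∶ B [ x ≔ N ]
      conv : ∀ {Γ M A B s} → Γ ⊢ M ∶ A → A ≃β B → Γ ⊢ B ∶ c s → Γ ⊢ M ∶ B

  _∶_⇀_ : Subst → Context → Context → Set
  σ ∶ Γ ⇀ Δ = ∀ {x A} → (x , A) ∈ Γ → Δ ⊢ σ x ∶ (A • σ)

-- A substitution acts on a term only through its free variables. Well-typedness
-- confines the free variables of A, and of every type in Γ, to dom Γ, which avoids x;
-- so updating σ at x changes neither A • σ nor any B • σ with (z , B) ∈ Γ. The entry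
-- for x is then an instance of the variable rule in Δ , y : A • σ, and each old entry
-- is a judgement of Δ weakened to Δ , y : A • σ.
module Submission where

open import Defs
open import Data.List using (List; _∷_; concat; map)
open import Data.List.Properties using (map-cong-local)
open import Data.List.Membership.Propositional using (_∈_; _∉_; lose)
open import Data.List.Membership.Propositional.Properties
  using (∈-map⁺; ∈-++⁺ˡ; ∈-++⁺ʳ; ∈-++⁻; ∈-filter⁺; ∈-filter⁻; ∈-concatMap⁺)
open import Data.List.Relation.Binary.Subset.Propositional using (_⊆_)
open import Data.List.Relation.Binary.Subset.Propositional.Properties using (map⁺)
open import Data.List.Relation.Unary.All using (tabulate)
open import Data.List.Relation.Unary.Any using (here; there)
open import Data.Product using (_×_; _,_; proj₁; proj₂)
open import Data.Sum using (inj₁; inj₂)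
open import Data.Empty using (⊥-elim)
open import Function using (_∘_)
open import Relation.Nullary using (¬_; yes; no)
open import Relation.Nullary.Decidable using (¬?)
open import Relation.Binary.PropositionalEquality

module Properties (S : Setup) where
  open Theory S

  X'-fresh : ∀ xs → X' xs ∉ xs
  X'-fresh xs X'∈xs
    with encode-X'∈ ← ∈-map⁺ encode X'∈xs
    rewrite encode-decode (χ' (map encode xs)) = χ'-fresh _ encode-X'∈

  ∈-remove⁺ : ∀ {z x} xs → z ∈ xs → ¬ z ≡ x → z ∈ xs - x
  ∈-remove⁺ {x = x} xs = ∈-filter⁺ (λ y → ¬? (y ≟V x))

  ∈-remove⁻ : ∀ {z x} xs → z ∈ xs - x → z ∈ xs × ¬ z ≡ x
  ∈-remove⁻ {x = x} xs = ∈-filter⁻ (λ y → ¬? (y ≟V x))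

  update-≡ : ∀ σ x N → (σ , x ≔ N) x ≡ N
  update-≡ σ x N with x ≟V x
  ... | yes _ = refl
  ... | no x≢x = ⊥-elim (x≢x refl)

  update-≢ : ∀ σ x N {z} → ¬ z ≡ x → (σ , x ≔ N) z ≡ σ z
  update-≢ σ x N {z} z≢x with z ≟V x
  ... | yes z≡x = ⊥-elim (z≢x z≡x)
  ... | no _ = refl

  Agree : List V → Subst → Subst → Set
  Agree xs σ τ = ∀ {z} → z ∈ xs → σ z ≡ τ z

  update-agree : ∀ {σ τ} xs x N → Agree (xs - x) σ τ → Agree xs (σ , x ≔ N) (τ , x ≔ N)
  update-agree xs x N σ≡τ {z} z∈xs with z ≟V x
  ... | yes _ = refl
  ... | no z≢x = σ≡τ (∈-remove⁺ xs z∈xs z≢x)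

  X-cong : ∀ {σ τ} xs → Agree xs σ τ → X σ xs ≡ X τ xs
  X-cong xs σ≡τ = cong (X' ∘ concat) (map-cong-local (tabulate (cong fv ∘ σ≡τ)))

  X-fresh : ∀ σ xs {z w} → z ∈ xs → w ∈ fv (σ z) → ¬ w ≡ X σ xs
  X-fresh σ xs z∈xs w∈σz refl = X'-fresh _ (∈-concatMap⁺ (fv ∘ σ) (lose z∈xs w∈σz))

  under : Subst → V → Term → V × Term
  under σ x M = let y = X σ (fv M - x) in y , M • (σ , x ≔ v y)

  •-cong : ∀ M {σ τ} → Agree (fv M) σ τ → M • σ ≡ M • τ

  under-cong : ∀ x M {σ τ} → Agree (fv M - x) σ τ → under σ x M ≡ under τ x M
  under-cong x M {σ} {τ} σ≡τ rewrite X-cong (fv M - x) σ≡τ =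
    cong (_ ,_) (•-cong M (update-agree (fv M) x _ σ≡τ))

  •-cong (c k) σ≡τ = refl
  •-cong (v x) σ≡τ = σ≡τ (here refl)
  •-cong (M · N) σ≡τ = cong₂ _·_ (•-cong M (σ≡τ ∘ ∈-++⁺ˡ)) (•-cong N (σ≡τ ∘ ∈-++⁺ʳ (fv M)))
  •-cong (lam x A M) σ≡τ =
    cong₂ (λ A' b → lam (proj₁ b) A' (proj₂ b))
      (•-cong A (σ≡τ ∘ ∈-++⁺ˡ)) (under-cong x M (σ≡τ ∘ ∈-++⁺ʳ (fv A)))
  •-cong (pi x A B) σ≡τ =
    cong₂ (λ A' b → pi (proj₁ b) A' (proj₂ b))
      (•-cong A (σ≡τ ∘ ∈-++⁺ˡ)) (under-cong x B (σ≡τ ∘ ∈-++⁺ʳ (fv A)))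

  fv-• : ∀ M σ {z w} → z ∈ fv M → w ∈ fv (σ z) → w ∈ fv (M • σ)

  fv-under : ∀ σ x M {z w} → z ∈ fv M - x → w ∈ fv (σ z)
           → w ∈ fv (proj₂ (under σ x M)) - proj₁ (under σ x M)
  fv-under σ x M {z} z∈M-x w∈σz with z∈M , z≢x ← ∈-remove⁻ (fv M) z∈M-x =
    ∈-remove⁺ (fv (proj₂ (under σ x M)))
      (fv-• M _ z∈M (subst (λ t → _ ∈ fv t) (sym (update-≢ σ x _ z≢x)) w∈σz))
      (X-fresh σ (fv M - x) z∈M-x w∈σz)

  fv-• (v x) σ (here refl) w∈σz = w∈σz
  fv-• (M · N) σ z∈ w∈σz with ∈-++⁻ (fv M) z∈
  ... | inj₁ z∈M = ∈-++⁺ˡ (fv-• M σ z∈M w∈σz)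
  ... | inj₂ z∈N = ∈-++⁺ʳ (fv (M • σ)) (fv-• N σ z∈N w∈σz)
  fv-• (lam x A M) σ z∈ w∈σz with ∈-++⁻ (fv A) z∈
  ... | inj₁ z∈A = ∈-++⁺ˡ (fv-• A σ z∈A w∈σz)
  ... | inj₂ z∈M-x = ∈-++⁺ʳ (fv (A • σ)) (fv-under σ x M z∈M-x w∈σz)
  fv-• (pi x A B) σ z∈ w∈σz with ∈-++⁻ (fv A) z∈
  ... | inj₁ z∈A = ∈-++⁺ˡ (fv-• A σ z∈A w∈σz)
  ... | inj₂ z∈B-x = ∈-++⁺ʳ (fv (A • σ)) (fv-under σ x B z∈B-x w∈σz)

  •-update-fresh : ∀ M σ {x} N → x ∉ fv M → M • σ ≡ M • (σ , x ≔ N)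
  •-update-fresh M σ N x∉M = •-cong M λ z∈M → sym (update-≢ σ _ N λ { refl → x∉M z∈M })

  fv-binder⊆dom : ∀ Γ A x M
    → (∀ y → y ∉ dom Γ → fv (M [ x ≔ v y ]) ⊆ dom (Γ ,, y ∶ A))
    → fv M - x ⊆ dom Γ
  fv-binder⊆dom Γ A x M fv⊆ {z} z∈M-x
    with z∈M , z≢x ← ∈-remove⁻ (fv M) z∈M-x
    with fv⊆ y y∉Γ (fv-• M _ z∈M (subst (λ t → z ∈ fv t) (sym (update-≢ ι x _ z≢x)) (here refl)))
    where
    -- y is chosen fresh for z as well, so that z cannot be the new variable.
    y = X' (z ∷ dom Γ)
    y∉Γ : y ∉ dom Γ
    y∉Γ = X'-fresh (z ∷ dom Γ) ∘ there
  ... | here z≡y = ⊥-elim (X'-fresh (z ∷ dom Γ) (here (sym z≡y)))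
  ... | there z∈Γ = z∈Γ

  fv⊆dom : ∀ {Γ M A} → Γ ⊢ M ∶ A → fv M ⊆ dom Γ
  fv⊆dom (var _ xA∈Γ) (here refl) = ∈-map⁺ proj₁ xA∈Γ
  fv⊆dom {Γ} (prod {x = x} {A = A} {B = B} ⊢A ⊢B _) z∈ with ∈-++⁻ (fv A) z∈
  ... | inj₁ z∈A = fv⊆dom ⊢A z∈A
  ... | inj₂ z∈B-x = fv-binder⊆dom Γ A x B (λ y y∉Γ → fv⊆dom (⊢B y y∉Γ)) z∈B-x
  fv⊆dom {Γ} (abs {x = x} {A = A} {M = M} ⊢A _ ⊢M _) z∈ with ∈-++⁻ (fv A) z∈
  ... | inj₁ z∈A = fv⊆dom ⊢A z∈A
  ... | inj₂ z∈M-x = fv-binder⊆dom Γ A x M (λ y y∉Γ → fv⊆dom (⊢M y y∉Γ)) z∈M-x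
  fv⊆dom (app {M = M} ⊢M ⊢N _) z∈ with ∈-++⁻ (fv M) z∈
  ... | inj₁ z∈M = fv⊆dom ⊢M z∈M
  ... | inj₂ z∈N = fv⊆dom ⊢N z∈N
  fv⊆dom (conv ⊢M _ _) = fv⊆dom ⊢M

  ⊢⇒ok : ∀ {Γ M A} → Γ ⊢ M ∶ A → Γ ok
  ⊢⇒ok (sort Γok _) = Γok
  ⊢⇒ok (prod ⊢A _ _) = ⊢⇒ok ⊢A
  ⊢⇒ok (var Γok _) = Γok
  ⊢⇒ok (abs ⊢A _ _ _) = ⊢⇒ok ⊢A
  ⊢⇒ok (app ⊢M _ _) = ⊢⇒ok ⊢M
  ⊢⇒ok (conv ⊢M _ _) = ⊢⇒ok ⊢M

  ok⇒fv⊆dom : ∀ {Γ z B} → Γ ok → (z , B) ∈ Γ → fv B ⊆ dom Γ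
  ok⇒fv⊆dom (cons _ ⊢A _) (here refl) = there ∘ fv⊆dom ⊢A
  ok⇒fv⊆dom (cons Γok _ _) (there zB∈Γ) = there ∘ ok⇒fv⊆dom Γok zB∈Γ

  weaken : ∀ {Γ Γ' M A} → Γ ⊆ Γ' → Γ' ok → Γ ⊢ M ∶ A → Γ' ⊢ M ∶ A

  weaken-binder : ∀ {Γ Γ' A s} {M T : V → Term} → Γ ⊆ Γ' → Γ' ok → Γ' ⊢ A ∶ c s
    → (∀ y → y ∉ dom Γ → (Γ ,, y ∶ A) ⊢ M y ∶ T y)
    → (∀ y → y ∉ dom Γ' → (Γ' ,, y ∶ A) ⊢ M y ∶ T y)
  weaken-binder Γ⊆Γ' Γ'ok ⊢A ⊢M y y∉Γ' =
    weaken (λ { (here e) → here e ; (there p) → there (Γ⊆Γ' p) }) (cons Γ'ok ⊢A y∉Γ')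
      (⊢M y (y∉Γ' ∘ map⁺ proj₁ Γ⊆Γ'))

  weaken Γ⊆Γ' Γ'ok (sort _ ax) = sort Γ'ok ax
  weaken Γ⊆Γ' Γ'ok (var _ xA∈Γ) = var Γ'ok (Γ⊆Γ' xA∈Γ)
  weaken Γ⊆Γ' Γ'ok (prod ⊢A ⊢B r) = prod ⊢A' (weaken-binder Γ⊆Γ' Γ'ok ⊢A' ⊢B) r
    where ⊢A' = weaken Γ⊆Γ' Γ'ok ⊢A
  weaken Γ⊆Γ' Γ'ok (abs ⊢A ⊢B ⊢M r) =
    abs ⊢A' (weaken-binder Γ⊆Γ' Γ'ok ⊢A' ⊢B) (weaken-binder Γ⊆Γ' Γ'ok ⊢A' ⊢M) r
    where ⊢A' = weaken Γ⊆Γ' Γ'ok ⊢A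
  weaken Γ⊆Γ' Γ'ok (app ⊢M ⊢N ⊢B) =
    app (weaken Γ⊆Γ' Γ'ok ⊢M) (weaken Γ⊆Γ' Γ'ok ⊢N) (weaken Γ⊆Γ' Γ'ok ⊢B)
  weaken Γ⊆Γ' Γ'ok (conv ⊢M A≃B ⊢B) = conv (weaken Γ⊆Γ' Γ'ok ⊢M) A≃B (weaken Γ⊆Γ' Γ'ok ⊢B)

lemma19 : (S : Setup) → let open Theory S in
    ∀ (Γ Δ : Context) (x y : V) (s : C) (A : Term) (σ : Subst)
    → x ∉ dom Γ → y ∉ dom Δ
    → Γ ⊢ A ∶ c s → Δ ⊢ (A • σ) ∶ c s
    → σ ∶ Γ ⇀ Δ
    → (σ , x ≔ v y) ∶ (Γ ,, x ∶ A) ⇀ (Δ ,, y ∶ (A • σ))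
lemma19 S Γ Δ x y s A σ x∉Γ y∉Δ ⊢A ⊢Aσ σ⇀ = σ,x≔y⇀
  where
  open Theory S
  open Properties S

  Δ,y = Δ ,, y ∶ (A • σ)
  Δ,y-ok : Δ,y ok
  Δ,y-ok = cons (⊢⇒ok ⊢Aσ) ⊢Aσ y∉Δ

  σ,x≔y⇀ : (σ , x ≔ v y) ∶ (Γ ,, x ∶ A) ⇀ Δ,y
  σ,x≔y⇀ (here refl) =
    subst₂ (Δ,y ⊢_∶_) (sym (update-≡ σ x (v y)))
      (•-update-fresh A σ (v y) (x∉Γ ∘ fv⊆dom ⊢A))
      (var Δ,y-ok (here refl))
  σ,x≔y⇀ {z} {B} (there zB∈Γ) =
    subst₂ (Δ,y ⊢_∶_) (sym (update-≢ σ x (v y) λ { refl → x∉Γ (∈-map⁺ proj₁ zB∈Γ) }))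
      (•-update-fresh B σ (v y) (x∉Γ ∘ ok⇒fv⊆dom (⊢⇒ok ⊢A) zB∈Γ))
      (weaken there Δ,y-ok (σ⇀ zB∈Γ))
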